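{- For each $n\geq 2$, there are no regular measures on $\partial\mathfrak{T}_3(n)$.
   Context: $\partial\mathfrak{T}_3(n)$: finite rooted trees in which each non-leaf vertex (node) has exactly two unordered children and a color in $\{1,\dots,n\}$ (leaves uncolored), regarded as structures on their leaf sets: isomorphisms are induced by color-preserving rooted-tree isomorphisms, the substructure on a leaf subset is the spanned tree (rooted at the lowest common ancestor, single-child vertices suppressed, colors kept), embeddings are identifications with substructures. A measure on a class of finite structures is a $\mathbb{C}$-valued function $\mu$ on embeddings with $\mu(\mathrm{iso})=1$, $\mu(j\circ i)=\mu(j)\mu(i)$, and $\mu(i)=\sum_k\mu(i'_k)$ for embeddings $i:W\to X$, $j:W\to Y$, where $Z_k$ runs over all amalgamations of $X,Y$ over $W$ in the class (structures with jointly surjective embeddings of $X,Y$ agreeing on $W$, up to compatible isomorphism) and $i'_k:Y\to Z_k$. A measure is regular if $\mu(i)\neq0$ for every embedding $i$. -}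

module Defs where

open import Level using (Level; _⊔_) renaming (suc to lsuc)
open import Data.Nat using (ℕ; zero; suc)
open import Data.Fin using (Fin) renaming (_≟_ to _≟ᶠ_)
open import Data.Bool using (Bool; true; false; _∨_)
open import Data.Maybe using (Maybe; just; nothing)
open import Data.Product using (Σ; ∃; _×_; _,_)
open import Data.Sum using (_⊎_)
open import Data.List using (List; []; _∷_; _++_; allFin; foldr; map)
open import Data.List.Relation.Binary.Permutation.Propositional using (_↭_)
open import Data.List.Relation.Unary.Any using (Any)
open import Data.List.Relation.Unary.AllPairs using (AllPairs)
open import Data.Vec using (Vec; lookup) renaming ([] to []ᵥ; _∷_ to _∷ᵥ_; map to mapᵥ)
open import Relation.Nullary using (¬_; does)
open import Relation.Binary.PropositionalEquality using (_≡_)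
open import Algebra.Bundles using (CommutativeRing)
import Algebra.Definitions.RawMonoid as RawMonoidDefs

-- Raw colored binary trees: leaves labelled by A, nodes colored by Fin n
-- (color i ∈ Fin n stands for color i+1 ∈ {1,…,n}).  Children are stored
-- in an order, but the order is irrelevant: see _∼_ below.

data BT (n : ℕ) (A : Set) : Set where
  leaf : A → BT n A
  node : Fin n → BT n A → BT n A → BT n A

module _ {n : ℕ} where

  leaves : {A : Set} → BT n A → List A
  leaves (leaf x) = x ∷ []
  leaves (node c l r) = leaves l ++ leaves r

  mapT : {A B : Set} → (A → B) → BT n A → BT n B
  mapT f (leaf x) = leaf (f x)
  mapT f (node c l r) = node c (mapT f l) (mapT f r)

  -- Spanned subtree on the leaves satisfying p: rooted at the lowest common
  -- ancestor, single-child vertices suppressed, colors kept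
  -- (nothing if no leaf is kept).
  filterT : {A : Set} → (A → Bool) → BT n A → Maybe (BT n A)
  filterT p (leaf x) with p x
  ... | true = just (leaf x)
  ... | false = nothing
  filterT p (node c l r) with filterT p l | filterT p r
  ... | just l′ | just r′ = just (node c l′ r′)
  ... | just l′ | nothing = just l′
  ... | nothing | just r′ = just r′
  ... | nothing | nothing = nothing

  -- Color-preserving rooted-tree isomorphism which is the identity on the
  -- leaf labels (children are unordered).
  data _∼_ {A : Set} : BT n A → BT n A → Set where
    leaf∼ : ∀ x → leaf x ∼ leaf x
    keep∼ : ∀ c {l l′ r r′} → l ∼ l′ → r ∼ r′ → node c l r ∼ node c l′ r′
    swap∼ : ∀ c {l l′ r r′} → l ∼ l′ → r ∼ r′ → node c l r ∼ node c r′ l′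

  -- A structure of ∂𝔗₃(n) on the leaf set Fin k: every label occurs exactly once.
  IsStr : {k : ℕ} → BT n (Fin k) → Set
  IsStr {k} t = leaves t ↭ allFin k

  -- maps Fin a → Fin b are encoded as vectors (lookup f)
  inImg : {a b : ℕ} → Vec (Fin b) a → Fin b → Bool
  inImg []ᵥ y = false
  inImg (x ∷ᵥ xs) y = does (x ≟ᶠ y) ∨ inImg xs y

  _∘ᵥ_ : {a b c : ℕ} → Vec (Fin c) b → Vec (Fin b) a → Vec (Fin c) a
  j ∘ᵥ i = mapᵥ (lookup j) i

  IsEmb : {a b : ℕ} → BT n (Fin a) → BT n (Fin b) → Vec (Fin b) a → Set
  IsEmb W X f =
    (∀ p q → lookup f p ≡ lookup f q → p ≡ q) ×
    (∃ λ t → (filterT (inImg f) X ≡ just t) × (mapT (lookup f) W ∼ t))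

  record Amalg {w x y : ℕ} (W : BT n (Fin w)) (X : BT n (Fin x)) (Y : BT n (Fin y))
               (i : Vec (Fin x) w) (j : Vec (Fin y) w) : Set where
    field
      m      : ℕ
      Z      : BT n (Fin m)
      Z-str  : IsStr Z
      emX    : Vec (Fin m) x
      emY    : Vec (Fin m) y
      emX-ok : IsEmb X Z emX
      emY-ok : IsEmb Y Z emY
      agree  : emX ∘ᵥ i ≡ emY ∘ᵥ j
      jsurj  : ∀ z → (∃ λ p → lookup emX p ≡ z) ⊎ (∃ λ q → lookup emY q ≡ z)

  open Amalg

  -- Compatible isomorphism of amalgamations (σ is automatically bijective,
  -- since both amalgamations are jointly surjective).
  Compat : {w x y : ℕ} {W : BT n (Fin w)} {X : BT n (Fin x)} {Y : BT n (Fin y)}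
           {i : Vec (Fin x) w} {j : Vec (Fin y) w} →
           Amalg W X Y i j → Amalg W X Y i j → Set
  Compat A B = Σ (Vec (Fin (m B)) (m A)) λ σ →
    IsEmb (Z A) (Z B) σ × (σ ∘ᵥ emX A ≡ emX B) × (σ ∘ᵥ emY A ≡ emY B)

  module _ {c ℓ : Level} (R : CommutativeRing c ℓ) where
    open CommutativeRing R

    -- a function on embeddings (arguments: domain, codomain, map)
    Fn : Set c
    Fn = ∀ {a b} → BT n (Fin a) → BT n (Fin b) → Vec (Fin b) a → Carrier

    Σᴿ : List Carrier → Carrier
    Σᴿ = foldr _+_ 0#

    record IsMeasure (μ : Fn) : Set ℓ where
      field
        iso  : ∀ {a} (W X : BT n (Fin a)) (σ : Vec (Fin a) a) →
               IsStr W → IsStr X → IsEmb W X σ → μ W X σ ≈ 1#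
        comp : ∀ {a b d} (W : BT n (Fin a)) (X : BT n (Fin b)) (Y : BT n (Fin d))
               (i : Vec (Fin b) a) (j : Vec (Fin d) b) →
               IsStr W → IsStr X → IsStr Y → IsEmb W X i → IsEmb X Y j →
               μ W Y (j ∘ᵥ i) ≈ μ X Y j * μ W X i
        amalg : ∀ {w x y} (W : BT n (Fin w)) (X : BT n (Fin x)) (Y : BT n (Fin y))
                (i : Vec (Fin x) w) (j : Vec (Fin y) w) →
                IsStr W → IsStr X → IsStr Y → IsEmb W X i → IsEmb W Y j →
                (L : List (Amalg W X Y i j)) →
                (∀ A → Any (Compat A) L) →
                AllPairs (λ A B → ¬ Compat A B) L →
                μ W X i ≈ Σᴿ (map (λ A → μ Y (Z A) (emY A)) L)

    Regular : Fn → Set ℓ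
    Regular μ = ∀ {a b} (W : BT n (Fin a)) (X : BT n (Fin b)) (f : Vec (Fin b) a) →
                IsStr W → IsStr X → IsEmb W X f → ¬ (μ W X f ≈ 0#)

-- Fields of characteristic zero (stand-in for ℂ)

module _ {c ℓ : Level} (R : CommutativeRing c ℓ) where
  open CommutativeRing R
  open RawMonoidDefs +-rawMonoid using () renaming (_×_ to _·_)

  IsField : Set (c ⊔ ℓ)
  IsField = (¬ (1# ≈ 0#)) × (∀ x → ¬ (x ≈ 0#) → ∃ λ y → x * y ≈ 1#)

  CharZero : Set ℓ
  CharZero = ∀ k → k · 1# ≈ 0# → k ≡ 0

module Submission where

open import Defs
open import Level using (Level)
open import Algebra.Bundles using (CommutativeRing)
open import Data.Nat using (ℕ; suc; _≤_; s≤s; z≤n)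
open import Data.Fin using (Fin; #_; _≟_) renaming (zero to fz; suc to fs)
open import Data.Bool using (Bool; true; false; _∨_; T)
open import Data.Bool.Properties using (T-∨; ∨-comm)
open import Data.Maybe using (just; nothing; maybe′)
open import Data.Product using (∃; _×_; _,_; proj₁; proj₂)
open import Data.Sum using (_⊎_; inj₁; inj₂; [_,_]′)
import Data.Sum as Sum
open import Data.Empty using (⊥; ⊥-elim)
open import Data.Unit using (tt)
open import Function using (_∘_; id)
open import Function.Bundles using (Equivalence)
open import Data.List using ([]; _∷_; filterᵇ)
open import Data.List.Properties using (filter-++; ++-identityʳ)
open import Data.List.Membership.Propositional using (_∈_; find)
open import Data.List.Membership.Propositional.Properties using (∈-filter⁺; ∈-filter⁻)
open import Data.List.Relation.Unary.All as All using (All; []; _∷_)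
open import Data.List.Relation.Unary.All.Properties using (++⁻ˡ; ++⁻ʳ)
open import Data.List.Relation.Unary.Any using (Any; here; there)
open import Data.List.Relation.Unary.Any.Properties using (++⁺ˡ)
open import Data.List.Relation.Unary.AllPairs using ([]; _∷_)
open import Data.List.Relation.Binary.Permutation.Propositional
  using (_↭_; refl; prep; swap; ↭-refl; ↭-trans)
open import Data.List.Relation.Binary.Permutation.Propositional.Properties
  using (++⁺; ++-comm; ∈-resp-↭)
open import Data.Vec using (Vec; []; _∷_; lookup; tabulate) renaming (map to mapᵥ)
open import Data.Vec.Properties using (lookup-map; lookup∘tabulate; map-∘; map-cong; map-id)
open import Data.Vec.Relation.Unary.All using ([]; _∷_)
open import Data.Vec.Relation.Unary.Unique.Propositional using (Unique; []; _∷_)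
open import Data.Vec.Relation.Unary.Unique.Propositional.Properties using (lookup-injective)
open import Relation.Nullary using (¬_; yes; no; does)
open import Relation.Nullary.Decidable using (T?; dec-true)
open import Relation.Binary.PropositionalEquality
  using (_≡_; _≢_; refl; sym; trans; cong; cong₂; subst; module ≡-Reasoning)
open ≡-Reasoning

-- Let W be the cherry b(0 1) and let X = a((0 1) 2) and Y = b((0 1) 2) be its
-- extensions by one leaf, with root colours a ≠ b.  In an amalgam Z of X and Y
-- the root separates the leaves of X or those of Y; the tree that is separated
-- gives the root its colour, and since the colours differ the other tree lies
-- on one side of the root.  Hence amalgamating X and Y over W embedded as the
-- leaves 0 1 of both gives exactly Z₁ = a(Y 3) and Z₂ = b(X 2), while embedding
-- W into the leaves 0 2 of Y leaves only Z₁.  The amalgamation axiom then reads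
-- μ(W ↪ X) = μ(Y ↪ Z₁) + μ(Y ↪ Z₂) = μ(Y ↪ Z₁), so μ(Y ↪ Z₂) = 0.

module _ {n : ℕ} {A : Set} where

  ∼-refl : (t : BT n A) → t ∼ t
  ∼-refl (leaf x) = leaf∼ x
  ∼-refl (node c l r) = keep∼ c (∼-refl l) (∼-refl r)

  ∼-sym : {t u : BT n A} → t ∼ u → u ∼ t
  ∼-sym (leaf∼ x) = leaf∼ x
  ∼-sym (keep∼ c p q) = keep∼ c (∼-sym p) (∼-sym q)
  ∼-sym (swap∼ c p q) = swap∼ c (∼-sym q) (∼-sym p)

  ∼-trans : {t u v : BT n A} → t ∼ u → u ∼ v → t ∼ v
  ∼-trans (leaf∼ x) (leaf∼ .x) = leaf∼ x
  ∼-trans (keep∼ c p q) (keep∼ .c p′ q′) = keep∼ c (∼-trans p p′) (∼-trans q q′)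
  ∼-trans (keep∼ c p q) (swap∼ .c p′ q′) = swap∼ c (∼-trans p p′) (∼-trans q q′)
  ∼-trans (swap∼ c p q) (keep∼ .c p′ q′) = swap∼ c (∼-trans p q′) (∼-trans q p′)
  ∼-trans (swap∼ c p q) (swap∼ .c p′ q′) = keep∼ c (∼-trans p q′) (∼-trans q p′)

  ∼-colour : ∀ {c c′} {l r l′ r′ : BT n A} → node c l r ∼ node c′ l′ r′ → c ≡ c′
  ∼-colour (keep∼ _ _ _) = refl
  ∼-colour (swap∼ _ _ _) = refl

  leaves-∼ : {t u : BT n A} → t ∼ u → leaves t ↭ leaves u
  leaves-∼ (leaf∼ x) = ↭-refl
  leaves-∼ (keep∼ c p q) = ++⁺ (leaves-∼ p) (leaves-∼ q)
  leaves-∼ (swap∼ c {l′ = l′} {r′ = r′} p q) =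
    ↭-trans (++⁺ (leaves-∼ p) (leaves-∼ q)) (++-comm (leaves l′) (leaves r′))

  ∈-∼ : ∀ {t u : BT n A} {z} → t ∼ u → z ∈ leaves t → z ∈ leaves u
  ∈-∼ t∼u = ∈-resp-↭ (leaves-∼ t∼u)

  All⇒Any-leaves : ∀ {P : A → Set} (t : BT n A) → All P (leaves t) → Any P (leaves t)
  All⇒Any-leaves (leaf x) (px ∷ _) = here px
  All⇒Any-leaves (node c l r) ps = ++⁺ˡ (All⇒Any-leaves l (++⁻ˡ (leaves l) ps))

module _ {n : ℕ} {A B : Set} where

  mapT-∼ : (f : A → B) {t u : BT n A} → t ∼ u → mapT f t ∼ mapT f u
  mapT-∼ f (leaf∼ x) = leaf∼ (f x)
  mapT-∼ f (keep∼ c p q) = keep∼ c (mapT-∼ f p) (mapT-∼ f q)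
  mapT-∼ f (swap∼ c p q) = swap∼ c (mapT-∼ f p) (mapT-∼ f q)

  mapT-inverse : {f : A → B} {g : B → A} → (∀ x → g (f x) ≡ x) →
                 (t : BT n A) → mapT g (mapT f t) ≡ t
  mapT-inverse g∘f (leaf x) = cong leaf (g∘f x)
  mapT-inverse g∘f (node c l r) = cong₂ (node c) (mapT-inverse g∘f l) (mapT-inverse g∘f r)

module _ {n : ℕ} {A : Set} where

  module _ (p : A → Bool) where

    leaves-filterT : (t : BT n A) → maybe′ leaves [] (filterT p t) ≡ filterᵇ p (leaves t)
    leaves-filterT (leaf x) with p x
    ... | true = refl
    ... | false = refl
    leaves-filterT (node c l r)
      rewrite filter-++ (T? ∘ p) (leaves l) (leaves r)
            | sym (leaves-filterT l) | sym (leaves-filterT r)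
      with filterT p l | filterT p r
    ... | just u  | just v  = refl
    ... | just u  | nothing = sym (++-identityʳ (leaves u))
    ... | nothing | just v  = refl
    ... | nothing | nothing = refl

    ∈-filterT⁻ : ∀ t {u z} → filterT p t ≡ just u → z ∈ leaves u → z ∈ leaves t × T (p z)
    ∈-filterT⁻ t eq z∈u =
      ∈-filter⁻ (T? ∘ p)
        (subst (_ ∈_) (trans (cong (maybe′ leaves []) (sym eq)) (leaves-filterT t)) z∈u)

    ∈-filterT⁺ : ∀ t {u z} → filterT p t ≡ just u → z ∈ leaves t → T (p z) → z ∈ leaves u
    ∈-filterT⁺ t eq z∈t pz =
      subst (_ ∈_) (trans (sym (leaves-filterT t)) (cong (maybe′ leaves []) eq))
        (∈-filter⁺ (T? ∘ p) z∈t pz)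

    filterT-nothing : ∀ t {z} → filterT p t ≡ nothing → z ∈ leaves t → ¬ T (p z)
    filterT-nothing t eq z∈t pz
      with () ← subst (_ ∈_) (trans (sym (leaves-filterT t)) (cong (maybe′ leaves []) eq))
                      (∈-filter⁺ (T? ∘ p) z∈t pz)

    filterT-all : (t : BT n A) → All (T ∘ p) (leaves t) → filterT p t ≡ just t
    filterT-all (leaf x) (px ∷ []) with p x
    ... | true = refl
    filterT-all (node c l r) ps
      rewrite filterT-all l (++⁻ˡ (leaves l) ps) | filterT-all r (++⁻ʳ (leaves l) ps) = refl

    filterT-both : ∀ c (l r : BT n A) {u v} → filterT p l ≡ just u → filterT p r ≡ just v →
                   filterT p (node c l r) ≡ just (node c u v)
    filterT-both c l r eql eqr rewrite eql | eqr = refl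

    filterT-left : ∀ c (l r : BT n A) {u} → filterT p l ≡ just u → filterT p r ≡ nothing →
                   filterT p (node c l r) ≡ just u
    filterT-left c l r eql eqr rewrite eql | eqr = refl

    filterT-right : ∀ c (l r : BT n A) {v} → filterT p l ≡ nothing → filterT p r ≡ just v →
                    filterT p (node c l r) ≡ just v
    filterT-right c l r eql eqr rewrite eql | eqr = refl

    filterT-neither : ∀ c (l r : BT n A) → filterT p l ≡ nothing → filterT p r ≡ nothing →
                      filterT p (node c l r) ≡ nothing
    filterT-neither c l r eql eqr rewrite eql | eqr = refl

    Meets : BT n A → Set
    Meets t = ∃ λ u → filterT p t ≡ just u

    meets? : (t : BT n A) → Meets t ⊎ filterT p t ≡ nothing
    meets? t with filterT p t
    ... | just u  = inj₁ (u , refl)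
    ... | nothing = inj₂ refl

    meets : ∀ t {z} → z ∈ leaves t → T (p z) → Meets t
    meets t z∈t pz with meets? t
    ... | inj₁ m  = m
    ... | inj₂ eq = ⊥-elim (filterT-nothing t eq z∈t pz)

    Splits : BT n A → Set
    Splits (leaf _) = ⊥
    Splits (node _ l r) = Meets l × Meets r

  filterT-cong : {p p′ : A → Bool} → (∀ z → p z ≡ p′ z) → (t : BT n A) →
                 filterT p t ≡ filterT p′ t
  filterT-cong p≗p′ (leaf x) rewrite p≗p′ x = refl
  filterT-cong p≗p′ (node c l r) rewrite filterT-cong p≗p′ l | filterT-cong p≗p′ r = refl

  -- A record rather than a Σ-type, so that Z, p and X can be inferred from it.
  record _↾_≃_ (Z : BT n A) (p : A → Bool) (X : BT n A) : Set where
    constructor restricts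
    field
      {restriction} : BT n A
      filterT≡      : filterT p Z ≡ just restriction
      ∼restriction  : X ∼ restriction


  ↾-unique : ∀ {p} {Z X t : BT n A} → Z ↾ p ≃ X → filterT p Z ≡ just t → X ∼ t
  ↾-unique (restricts eq X∼t′) eq′ with refl ← trans (sym eq) eq′ = X∼t′

  ↾-colour : ∀ {p p′ c c′} {Z B E B′ E′ : BT n A} → (∀ z → p z ≡ p′ z) →
             Z ↾ p ≃ node c B E → Z ↾ p′ ≃ node c′ B′ E′ → c ≡ c′
  ↾-colour {Z = Z} p≗p′ (restricts eq X∼t) Zp′ =
    ∼-colour (∼-trans X∼t (∼-sym (↾-unique Zp′ (trans (sym (filterT-cong p≗p′ Z)) eq))))

  ↾-swap : ∀ {p c} {l r X : BT n A} → node c l r ↾ p ≃ X → node c r l ↾ p ≃ X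
  ↾-swap {p} {c} {l} {r} Zp with meets? p l | meets? p r
  ... | inj₁ (u , lp) | inj₁ (v , rp) =
    restricts (filterT-both p c r l rp lp)
      (∼-trans (↾-unique Zp (filterT-both p c l r lp rp)) (swap∼ c (∼-refl u) (∼-refl v)))
  ... | inj₁ (u , lp) | inj₂ rp =
    restricts (filterT-right p c r l rp lp) (↾-unique Zp (filterT-left p c l r lp rp))
  ... | inj₂ lp | inj₁ (v , rp) =
    restricts (filterT-left p c r l rp lp) (↾-unique Zp (filterT-right p c l r lp rp))
  ... | inj₂ lp | inj₂ rp
    with () ← trans (sym (filterT-neither p c l r lp rp)) (_↾_≃_.filterT≡ Zp)

  meets-via : ∀ {p q} (s : BT n A) {u X} → filterT q s ≡ just u → X ∼ u →
              Any (T ∘ p) (leaves X) → Meets p s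
  meets-via {p} {q} s sq X∼u Xp with z , z∈X , pz ← find Xp =
    meets p s (proj₁ (∈-filterT⁻ q s sq (∈-∼ X∼u z∈X))) pz

  splits-transfer : ∀ {p q c} {Z C D : BT n A} → Z ↾ q ≃ node c C D →
    Any (T ∘ p) (leaves C) → Any (T ∘ p) (leaves D) → Splits q Z → Splits p Z
  splits-transfer {q = q} {Z = node c l r} Zq Cp Dp ((u , lq) , (v , rq))
    with ↾-unique Zq (filterT-both q c l r lq rq)
  ... | keep∼ _ C∼u D∼v = meets-via l lq C∼u Cp , meets-via r rq D∼v Dp
  ... | swap∼ _ C∼v D∼u = meets-via l lq D∼u Dp , meets-via r rq C∼v Cp

module TwoRestrictions {n : ℕ} {A : Set} (p q : A → Bool) (cover : ∀ z → T (p z ∨ q z)) where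

  q-of-¬p : ∀ {z} → ¬ T (p z) → T (q z)
  q-of-¬p {z} ¬pz with Equivalence.to T-∨ (cover z)
  ... | inj₁ pz = ⊥-elim (¬pz pz)
  ... | inj₂ qz = qz

  p-of-¬q : ∀ {z} → ¬ T (q z) → T (p z)
  p-of-¬q {z} ¬qz with Equivalence.to T-∨ (cover z)
  ... | inj₁ pz = pz
  ... | inj₂ qz = ⊥-elim (¬qz qz)

  lies-in-q : ∀ (s : BT n A) {u B} → filterT p s ≡ just u → B ∼ u → All (T ∘ q) (leaves B) →
              filterT q s ≡ just s
  lies-in-q s sp B∼u Bq = filterT-all q s (All.tabulate q-leaf)
    where
    q-leaf : ∀ {z} → z ∈ leaves s → T (q z)
    q-leaf {z} z∈s with T? (p z)
    ... | yes pz = All.lookup Bq (∈-∼ (∼-sym B∼u) (∈-filterT⁺ p s sp z∈s pz))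
    ... | no ¬pz = q-of-¬p ¬pz

  misses-q⇒∼ : ∀ (s : BT n A) {e E} → filterT p s ≡ just e → E ∼ e → filterT q s ≡ nothing →
               s ∼ E
  misses-q⇒∼ s sp E∼e sq =
    ∼-sym (↾-unique (restricts {Z = s} sp E∼e)
                    (filterT-all p s (All.tabulate (p-of-¬q ∘ filterT-nothing q s sq))))

  misses-p⇒meets-q : (s : BT n A) → filterT p s ≡ nothing → Meets q s
  misses-p⇒meets-q s sp = s , filterT-all q s (All.tabulate (q-of-¬p ∘ filterT-nothing p s sp))

  -- The q-restriction cannot branch at the root, whose colour is c ≢ cq; so r has
  -- no q-leaf, and is therefore its own p-restriction E.
  attach-ordered : ∀ {c cq} {l r u e B C D E : BT n A} → c ≢ cq → All (T ∘ q) (leaves B) →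
    filterT p l ≡ just u → B ∼ u → filterT p r ≡ just e → E ∼ e →
    node c l r ↾ q ≃ node cq C D → node c l r ∼ node c (node cq C D) E
  attach-ordered {c} {l = l} {r} c≢cq Bq lp B∼u rp E∼e Zq
    with lq ← lies-in-q l lp B∼u Bq | meets? q r
  ... | inj₁ (_ , rq) = ⊥-elim (c≢cq (sym (∼-colour (↾-unique Zq (filterT-both q c l r lq rq)))))
  ... | inj₂ rq =
    keep∼ c (∼-sym (↾-unique Zq (filterT-left q c l r lq rq))) (misses-q⇒∼ r rp E∼e rq)

  splits⇒attach : ∀ {cp cq} {Z B C D E : BT n A} → cp ≢ cq → All (T ∘ q) (leaves B) →
    Z ↾ p ≃ node cp B E → Z ↾ q ≃ node cq C D → Splits p Z → Z ∼ node cp (node cq C D) E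
  splits⇒attach {Z = node c l r} cp≢cq Bq Zp Zq ((u , lp) , (v , rp))
    with ↾-unique Zp (filterT-both p c l r lp rp)
  ... | keep∼ _ B∼u E∼v = attach-ordered cp≢cq Bq lp B∼u rp E∼v Zq
  ... | swap∼ _ B∼v E∼u =
    ∼-trans (swap∼ c (∼-refl l) (∼-refl r)) (attach-ordered cp≢cq Bq rp B∼v lp E∼u (↾-swap Zq))

  p-or-q-splits : ∀ {c} {Z B E : BT n A} → Z ↾ p ≃ node c B E →
                  Any (T ∘ q) (leaves (node c B E)) → Splits p Z ⊎ Splits q Z
  p-or-q-splits {Z = leaf z} (restricts eq X∼t) _ with p z | eq
  ... | true | refl with () ← X∼t
  ... | false | ()
  p-or-q-splits {Z = node c l r} Zp Xq with meets? p l | meets? p r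
  ... | inj₁ lm | inj₁ rm = inj₁ (lm , rm)
  ... | inj₁ (u , lp) | inj₂ rp =
    inj₂ (meets-via l lp (↾-unique Zp (filterT-left p c l r lp rp)) Xq , misses-p⇒meets-q r rp)
  ... | inj₂ lp | inj₁ (v , rp) =
    inj₂ (misses-p⇒meets-q l lp , meets-via r rp (↾-unique Zp (filterT-right p c l r lp rp)) Xq)
  ... | inj₂ lp | inj₂ rp
    with () ← trans (sym (filterT-neither p c l r lp rp)) (_↾_≃_.filterT≡ Zp)

module _ {n : ℕ} {A : Set} {p q : A → Bool} (cover : ∀ z → T (p z ∨ q z)) where
  private
    module P = TwoRestrictions {n} p q cover
    module Q = TwoRestrictions {n} q p (λ z → subst T (∨-comm (p z) (q z)) (cover z))

  attach-either : ∀ {cp cq} {Z B C D E : BT n A} → cp ≢ cq →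
    All (T ∘ q) (leaves B) → All (T ∘ p) (leaves C) →
    Z ↾ p ≃ node cp B E → Z ↾ q ≃ node cq C D →
    Z ∼ node cp (node cq C D) E ⊎ Z ∼ node cq (node cp B E) D
  attach-either {B = B} cp≢cq Bq Cp Zp Zq
    with P.p-or-q-splits Zp (++⁺ˡ (All⇒Any-leaves B Bq))
  ... | inj₁ p-splits = inj₁ (P.splits⇒attach cp≢cq Bq Zp Zq p-splits)
  ... | inj₂ q-splits = inj₂ (Q.splits⇒attach (cp≢cq ∘ sym) Cp Zq Zp q-splits)

  attach-first : ∀ {cp cq} {Z B C D E : BT n A} → cp ≢ cq →
    All (T ∘ q) (leaves B) → Any (T ∘ p) (leaves C) → Any (T ∘ p) (leaves D) →
    Z ↾ p ≃ node cp B E → Z ↾ q ≃ node cq C D → Z ∼ node cp (node cq C D) E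
  attach-first {B = B} cp≢cq Bq Cp Dp Zp Zq =
    P.splits⇒attach cp≢cq Bq Zp Zq
      ([ id , splits-transfer Zq Cp Dp ]′ (P.p-or-q-splits Zp (++⁺ˡ (All⇒Any-leaves B Bq))))

-- inImg carries a spurious implicit colour count, which has to be fixed explicitly.
module _ {n : ℕ} where

  inImg-∋ : ∀ {k m} (v : Vec (Fin m) k) i {y} → lookup v i ≡ y → T (inImg {n} v y)
  inImg-∋ (x ∷ v) fz {y} e rewrite dec-true (x ≟ y) e = tt
  inImg-∋ (x ∷ v) (fs i) e = Equivalence.from T-∨ (inj₂ (inImg-∋ v i e))

  inImg-swap : ∀ {k m} (x y : Fin m) (v : Vec (Fin m) k) z →
               inImg {n} (x ∷ y ∷ v) z ≡ inImg {n} (y ∷ x ∷ v) z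
  inImg-swap x y v z with does (x ≟ z) | does (y ≟ z)
  ... | true  | true  = refl
  ... | true  | false = refl
  ... | false | _     = refl

  jointly-surjective⇒cover : ∀ {k l m} (f : Vec (Fin m) k) (g : Vec (Fin m) l) →
    (∀ z → (∃ λ i → lookup f i ≡ z) ⊎ (∃ λ i → lookup g i ≡ z)) →
    ∀ z → T (inImg {n} f z ∨ inImg {n} g z)
  jointly-surjective⇒cover f g js z =
    Equivalence.from T-∨ (Sum.map (λ (i , e) → inImg-∋ f i e) (λ (i , e) → inImg-∋ g i e) (js z))

  ↾-of-IsEmb : ∀ {k m} (W : BT n (Fin k)) {X : BT n (Fin m)} f → IsEmb W X f →
               X ↾ inImg {n} f ≃ mapT (lookup f) W
  ↾-of-IsEmb W f (_ , _ , eq , W∼t) = restricts eq W∼t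

lookup-≢ : ∀ {k m} (v : Vec (Fin m) k) → (∀ s t → lookup v s ≡ lookup v t → s ≡ t) →
           ∀ s t → s ≢ t → lookup v s ≢ lookup v t
lookup-≢ v injective s t s≢t = s≢t ∘ injective s t

module _ {n w x y : ℕ} {W : BT n (Fin w)} {X : BT n (Fin x)} {Y : BT n (Fin y)}
         {i : Vec (Fin x) w} {j : Vec (Fin y) w} where
  open Amalg

  relabel⇒Compat : (A B : Amalg W X Y i j) (v : Vec (Fin (m A)) (m B)) → Unique v →
    emX A ≡ mapᵥ (lookup v) (emX B) → emY A ≡ mapᵥ (lookup v) (emY B) →
    Z A ∼ mapT (lookup v) (Z B) → Compat A B
  relabel⇒Compat A B v unique eX eY ZA∼ = σ , σ-embedding , σ-inverts eX , σ-inverts eY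
    where
    preimage-via : ∀ {k} {u : Vec (Fin (m A)) k} (uB : Vec (Fin (m B)) k) →
                   u ≡ mapᵥ (lookup v) uB → ∀ {l z} → lookup u l ≡ z → ∃ λ t → lookup v t ≡ z
    preimage-via uB refl {l} e = lookup uB l , trans (sym (lookup-map l (lookup v) uB)) e

    preimage : ∀ z → ∃ λ t → lookup v t ≡ z
    preimage z = [ (λ (_ , e) → preimage-via (emX B) eX e)
                 , (λ (_ , e) → preimage-via (emY B) eY e) ]′ (jsurj A z)

    σ : Vec (Fin (m B)) (m A)
    σ = tabulate (proj₁ ∘ preimage)

    v∘σ : ∀ z → lookup v (lookup σ z) ≡ z
    v∘σ z rewrite lookup∘tabulate (proj₁ ∘ preimage) z = proj₂ (preimage z)

    σ∘v : ∀ t → lookup σ (lookup v t) ≡ t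
    σ∘v t = lookup-injective unique _ _ (v∘σ (lookup v t))

    σ-injective : ∀ z z′ → lookup σ z ≡ lookup σ z′ → z ≡ z′
    σ-injective z z′ e = trans (sym (v∘σ z)) (trans (cong (lookup v) e) (v∘σ z′))

    σ-embedding : IsEmb (Z A) (Z B) σ
    σ-embedding =
      σ-injective ,
      Z B ,
      filterT-all (inImg {n} σ) (Z B) (All.tabulate λ {t} _ → inImg-∋ {n} σ (lookup v t) (σ∘v t)) ,
      subst (mapT (lookup σ) (Z A) ∼_) (mapT-inverse σ∘v (Z B)) (mapT-∼ (lookup σ) ZA∼)

    σ-inverts : ∀ {k} {u : Vec (Fin (m A)) k} {uB} → u ≡ mapᵥ (lookup v) uB →
                mapᵥ (lookup σ) u ≡ uB
    σ-inverts {uB = uB} refl = begin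
      mapᵥ (lookup σ) (mapᵥ (lookup v) uB) ≡⟨ map-∘ (lookup σ) (lookup v) uB ⟨
      mapᵥ (lookup σ ∘ lookup v) uB        ≡⟨ map-cong σ∘v uB ⟩
      mapᵥ id uB                           ≡⟨ map-id uB ⟩
      uB                                   ∎

module Counterexample {n : ℕ} {a b : Fin n} (a≢b : a ≢ b) where
  open Amalg

  triple : ∀ {k} → Fin n → Fin k → Fin k → Fin k → BT n (Fin k)
  triple c x y z = node c (node b (leaf x) (leaf y)) (leaf z)

  W : BT n (Fin 2)
  W = node b (leaf (# 0)) (leaf (# 1))

  X Y : BT n (Fin 3)
  X = triple a (# 0) (# 1) (# 2)
  Y = triple b (# 0) (# 1) (# 2)

  Z₁ Z₂ : BT n (Fin 4)
  Z₁ = node a (triple b (# 0) (# 1) (# 2)) (leaf (# 3))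
  Z₂ = node b (triple a (# 0) (# 1) (# 3)) (leaf (# 2))

  Z₂-str : IsStr Z₂
  Z₂-str = prep _ (prep _ (swap _ _ refl))

  e01 e02 : Vec (Fin 3) 2
  e01 = # 0 ∷ # 1 ∷ []
  e02 = # 0 ∷ # 2 ∷ []

  e012 e013 e023 : Vec (Fin 4) 3
  e012 = # 0 ∷ # 1 ∷ # 2 ∷ []
  e013 = # 0 ∷ # 1 ∷ # 3 ∷ []
  e023 = # 0 ∷ # 2 ∷ # 3 ∷ []

  e01-unique : Unique e01
  e01-unique = ((λ ()) ∷ []) ∷ [] ∷ []

  e02-unique : Unique e02
  e02-unique = ((λ ()) ∷ []) ∷ [] ∷ []

  e012-unique : Unique e012
  e012-unique = ((λ ()) ∷ (λ ()) ∷ []) ∷ ((λ ()) ∷ []) ∷ [] ∷ []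

  e013-unique : Unique e013
  e013-unique = ((λ ()) ∷ (λ ()) ∷ []) ∷ ((λ ()) ∷ []) ∷ [] ∷ []

  e023-unique : Unique e023
  e023-unique = ((λ ()) ∷ (λ ()) ∷ []) ∷ ((λ ()) ∷ []) ∷ [] ∷ []

  embedding : ∀ {k l} (U : BT n (Fin k)) (V : BT n (Fin l)) (f : Vec (Fin l) k) → Unique f →
              filterT (inImg {n} f) V ≡ just (mapT (lookup f) U) → IsEmb U V f
  embedding U V f unique eq = lookup-injective unique , _ , eq , ∼-refl _

  Y↪Z₂ : IsEmb Y Z₂ e012
  Y↪Z₂ = embedding Y Z₂ e012 e012-unique refl

  jsurj-e012 : ∀ (u : Vec (Fin 4) 3) → lookup u (# 2) ≡ # 3 →
               ∀ z → (∃ λ s → lookup u s ≡ z) ⊎ (∃ λ s → lookup e012 s ≡ z)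
  jsurj-e012 u u₂≡3 fz = inj₂ (# 0 , refl)
  jsurj-e012 u u₂≡3 (fs fz) = inj₂ (# 1 , refl)
  jsurj-e012 u u₂≡3 (fs (fs fz)) = inj₂ (# 2 , refl)
  jsurj-e012 u u₂≡3 (fs (fs (fs fz))) = inj₁ (# 2 , u₂≡3)

  B₁ B₂ : Amalg W X Y e01 e01
  B₁ = record { m = 4 ; Z = Z₁ ; Z-str = refl ; emX = e013 ; emY = e012
              ; emX-ok = embedding X Z₁ e013 e013-unique refl
              ; emY-ok = embedding Y Z₁ e012 e012-unique refl
              ; agree = refl ; jsurj = jsurj-e012 e013 refl }
  B₂ = record { m = 4 ; Z = Z₂ ; Z-str = Z₂-str ; emX = e013 ; emY = e012
              ; emX-ok = embedding X Z₂ e013 e013-unique refl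
              ; emY-ok = Y↪Z₂
              ; agree = refl ; jsurj = jsurj-e012 e013 refl }

  B₃ : Amalg W X Y e01 e02
  B₃ = record { m = 4 ; Z = Z₁ ; Z-str = refl ; emX = e023 ; emY = e012
              ; emX-ok = embedding X Z₁ e023 e023-unique refl
              ; emY-ok = embedding Y Z₁ e012 e012-unique refl
              ; agree = refl ; jsurj = jsurj-e012 e023 refl }

  -- The compatibility equations force σ to be the identity, and Z₁ ≁ Z₂ by their root colours.
  B₁≉B₂ : ¬ Compat B₁ B₂
  B₁≉B₂ (_ ∷ _ ∷ _ ∷ _ ∷ [] , (_ , _ , refl , Z₁∼Z₂) , refl , refl) = a≢b (∼-colour Z₁∼Z₂)

  module AmalgamFacts {i j : Vec (Fin 3) 2} (A : Amalg W X Y i j) where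

    cover : ∀ z → T (inImg {n} (emX A) z ∨ inImg {n} (emY A) z)
    cover = jointly-surjective⇒cover {n} (emX A) (emY A) (jsurj A)

    X-restriction : Z A ↾ inImg {n} (emX A) ≃ mapT (lookup (emX A)) X
    X-restriction = ↾-of-IsEmb X (emX A) (emX-ok A)

    Y-restriction : Z A ↾ inImg {n} (emY A) ≃ mapT (lookup (emY A)) Y
    Y-restriction = ↾-of-IsEmb Y (emY A) (emY-ok A)

    in-X : ∀ s → T (inImg {n} (emX A) (lookup (emX A) s))
    in-X s = inImg-∋ {n} (emX A) s refl

    in-Y : ∀ s → T (inImg {n} (emY A) (lookup (emY A) s))
    in-Y s = inImg-∋ {n} (emY A) s refl

    X-distinct : ∀ s t → s ≢ t → lookup (emX A) s ≢ lookup (emX A) t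
    X-distinct = lookup-≢ (emX A) (proj₁ (emX-ok A))

    Y-distinct : ∀ s t → s ≢ t → lookup (emY A) s ≢ lookup (emY A) t
    Y-distinct = lookup-≢ (emY A) (proj₁ (emY-ok A))

  amalgams₁ : (A : Amalg W X Y e01 e01) → Any (Compat A) (B₁ ∷ B₂ ∷ [])
  amalgams₁ A@record { emX = x0 ∷ x1 ∷ x2 ∷ [] ; emY = .x0 ∷ .x1 ∷ y2 ∷ [] ; agree = refl } =
    [ here ∘ relabel⇒Compat A B₁ v v-unique refl refl
    , there ∘ here ∘ relabel⇒Compat A B₂ v v-unique refl refl
    ]′ (attach-either cover a≢b (in-Y (# 0) ∷ in-Y (# 1) ∷ []) (in-X (# 0) ∷ in-X (# 1) ∷ [])
                      X-restriction Y-restriction)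
    where
    open AmalgamFacts A

    -- Otherwise Z would restrict to X and to Y on the same three leaves.
    y2≢x2 : y2 ≢ x2
    y2≢x2 e = a≢b (↾-colour (λ z → cong (λ w → inImg {n} (x0 ∷ x1 ∷ w ∷ []) z) (sym e))
                            X-restriction Y-restriction)

    v : Vec (Fin (m A)) 4
    v = x0 ∷ x1 ∷ y2 ∷ x2 ∷ []

    v-unique : Unique v
    v-unique = (X-distinct (# 0) (# 1) (λ ()) ∷ Y-distinct (# 0) (# 2) (λ ())
                  ∷ X-distinct (# 0) (# 2) (λ ()) ∷ [])
             ∷ (Y-distinct (# 1) (# 2) (λ ()) ∷ X-distinct (# 1) (# 2) (λ ()) ∷ [])
             ∷ (y2≢x2 ∷ []) ∷ [] ∷ []

  amalgams₂ : (A : Amalg W X Y e01 e02) → Any (Compat A) (B₃ ∷ [])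
  amalgams₂ A@record { emX = x0 ∷ x1 ∷ x2 ∷ [] ; emY = .x0 ∷ y1 ∷ .x1 ∷ [] ; agree = refl } =
    here (relabel⇒Compat A B₃ v v-unique refl refl
           (attach-first cover a≢b (in-Y (# 0) ∷ in-Y (# 2) ∷ []) (here (in-X (# 0)))
                         (here (in-X (# 1))) X-restriction Y-restriction))
    where
    open AmalgamFacts A

    y1≢x2 : y1 ≢ x2
    y1≢x2 e = a≢b (↾-colour (λ z → trans (cong (does (x0 ≟ z) ∨_) (inImg-swap {n} x1 x2 [] z))
                                         (cong (λ w → inImg {n} (x0 ∷ w ∷ x1 ∷ []) z) (sym e)))
                            X-restriction Y-restriction)

    v : Vec (Fin (m A)) 4
    v = x0 ∷ y1 ∷ x1 ∷ x2 ∷ []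

    v-unique : Unique v
    v-unique = (Y-distinct (# 0) (# 1) (λ ()) ∷ X-distinct (# 0) (# 1) (λ ())
                  ∷ X-distinct (# 0) (# 2) (λ ()) ∷ [])
             ∷ (Y-distinct (# 1) (# 2) (λ ()) ∷ y1≢x2 ∷ [])
             ∷ (X-distinct (# 1) (# 2) (λ ()) ∷ []) ∷ [] ∷ []

  module _ {c ℓ} (R : CommutativeRing c ℓ) (μ : Fn {n} R) (isMeasure : IsMeasure {n} R μ) where
    private module R = CommutativeRing R
    open R using (_≈_; _+_; 0#)
    open IsMeasure isMeasure using (amalg)
    open import Algebra.Properties.Group R.+-group using (∙-cancelˡ)

    μ-Y↪Z₂≈0 : μ Y Z₂ e012 ≈ 0#
    μ-Y↪Z₂≈0 =
      R.trans (R.sym (R.+-identityʳ _)) (∙-cancelˡ _ _ _ (R.trans (R.sym two-amalgams) one-amalgam))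
      where
      W↪X : IsEmb W X e01
      W↪X = embedding W X e01 e01-unique refl

      two-amalgams : μ W X e01 ≈ μ Y Z₁ e012 + (μ Y Z₂ e012 + 0#)
      two-amalgams = amalg W X Y e01 e01 refl refl refl W↪X (embedding W Y e01 e01-unique refl)
                           (B₁ ∷ B₂ ∷ []) amalgams₁ ((B₁≉B₂ ∷ []) ∷ [] ∷ [])

      one-amalgam : μ W X e01 ≈ μ Y Z₁ e012 + 0#
      one-amalgam = amalg W X Y e01 e02 refl refl refl W↪X (embedding W Y e02 e02-unique refl)
                          (B₃ ∷ []) amalgams₂ ([] ∷ [])

corollary4p5 : ∀ {c ℓ : Level} (n : ℕ) → 2 ≤ n →
    (R : CommutativeRing c ℓ) → IsField R → CharZero R →
    (μ : Fn {n} R) → IsMeasure {n} R μ → ¬ Regular {n} R μ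
corollary4p5 (suc (suc _)) (s≤s (s≤s z≤n)) R _ _ μ isMeasure regular =
  regular Y Z₂ e012 refl Z₂-str Y↪Z₂ (μ-Y↪Z₂≈0 R μ isMeasure)
  where open Counterexample {a = fz} {b = fs fz} (λ ())
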